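{- Every pinned $d$-isostatic graph $\widetilde G=(I,P;E)$ has a $d$-directed orientation, i.e. an orientation of its edges in which every inner vertex has out-degree exactly $d$ and every pinned vertex has out-degree $0$.
   Context: Fix $d\ge 1$. A pinned graph $\widetilde G=(I,P;E)$ consists of disjoint finite sets $I$ (inner vertices) and $P$ (pinned vertices) and a finite multiset $E$ of edges, each an unordered pair of distinct vertices with at least one endpoint in $I$. A configuration $p$ assigns a point $p_v\in\mathbb R^d$ to each vertex. The pinned rigidity matrix $R(\widetilde G,p)$ is the $|E|\times d|I|$ matrix with one row per edge and a block of $d$ columns for each inner vertex: the row of an edge $\{i,j\}$ with $i,j\in I$ has $p_i-p_j$ in the columns of $i$, $p_j-p_i$ in the columns of $j$, and zeros elsewhere; the row of an edge $\{i,k\}$ with $i\in I$, $k\in P$ has $p_i-p_k$ in the columns of $i$ and zeros elsewhere. $\widetilde G$ is pinned $d$-isostatic if there is a configuration $p$ for which $R(\widetilde G,p)$ is square (so $|E|=d|I|$) and invertible. -}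

module Defs where

open import Level using (Level)
open import Data.Nat as ℕ using (ℕ; zero; suc)
open import Data.Fin using (Fin; zero; suc)
import Data.Fin.Properties as FinP
open import Data.Sum using (_⊎_; inj₁; inj₂)
import Data.Sum.Properties as SumP
open import Data.Product using (_×_; _,_; proj₁; proj₂; Σ; ∃)
open import Data.Bool using (Bool; true; false; if_then_else_)
open import Relation.Nullary using (¬_; does)
open import Relation.Binary.PropositionalEquality using (_≡_; _≢_)
open import Relation.Binary.Definitions using (DecidableEquality)
open import Algebra.Bundles using (CommutativeRing)

-- Vertices of a pinned graph with |I| = n inner and |P| = m pinned
-- vertices: inner vertices are inj₁ i, pinned vertices are inj₂ k.

Vertex : ℕ → ℕ → Set
Vertex n m = Fin n ⊎ Fin m

_≟V_ : ∀ {n m} → DecidableEquality (Vertex n m)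
_≟V_ = SumP.≡-dec FinP._≟_ FinP._≟_

IsInner : ∀ {n m} → Vertex n m → Set
IsInner (inj₁ _) = Data.Unit.⊤ where import Data.Unit
IsInner (inj₂ _) = Data.Empty.⊥ where import Data.Empty

-- A pinned graph (I, P; E): the multiset E is listed as a family of
-- e edges indexed by Fin e (parallel edges allowed).  Each edge is
-- stored as a pair of its endpoints; the pair is regarded as unordered
-- (the order is only a storage convention: both the rigidity matrix and
-- orientations below are symmetric in it).
record PinnedGraph (n m : ℕ) : Set where
  field
    e        : ℕ
    ends     : Fin e → Vertex n m × Vertex n m
    distinct : ∀ k → proj₁ (ends k) ≢ proj₂ (ends k)
    hasInner : ∀ k → IsInner (proj₁ (ends k)) ⊎ IsInner (proj₂ (ends k))

module _ {c ℓ} (R : CommutativeRing c ℓ) where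
  open CommutativeRing R using (Carrier; _≈_; _+_; _*_; _-_; 0#; 1#)

  ΣFin : ∀ k → (Fin k → Carrier) → Carrier
  ΣFin zero    f = 0#
  ΣFin (suc k) f = f zero + ΣFin k (λ i → f (suc i))

  IsField : Set (c Level.⊔ ℓ)
  IsField = (¬ (1# ≈ 0#)) × (∀ x → ¬ (x ≈ 0#) → Σ Carrier λ y → x * y ≈ 1#)

  Configuration : ℕ → ℕ → ℕ → Set c
  Configuration d n m = Vertex n m → Fin d → Carrier

  rigidityMatrix : ∀ {d n m} (G : PinnedGraph n m) → Configuration d n m →
                   Fin (PinnedGraph.e G) → Fin n × Fin d → Carrier
  rigidityMatrix G p k (i , a) =
    (if does (u ≟V inj₁ i) then p u a - p v a else 0#) +
    (if does (v ≟V inj₁ i) then p v a - p u a else 0#)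
    where
      u = proj₁ (PinnedGraph.ends G k)
      v = proj₂ (PinnedGraph.ends G k)

  idMat : ∀ {A : Set} → DecidableEquality A → A → A → Carrier
  idMat _≟_ x y = if does (x ≟ y) then 1# else 0#

  Invertible : ∀ e n d → (Fin e → Fin n × Fin d → Carrier) → Set (c Level.⊔ ℓ)
  Invertible e n d M =
    Σ (Fin n × Fin d → Fin e → Carrier) λ S →
      (∀ k l → ΣFin n (λ i → ΣFin d (λ a → M k (i , a) * S (i , a) l))
                 ≈ idMat FinP._≟_ k l)
      × (∀ x y → ΣFin e (λ k → S x k * M k y)
                 ≈ idMat (×-dec) x y)
    where
      ×-dec : DecidableEquality (Fin n × Fin d)
      ×-dec = Data.Product.Properties.≡-dec FinP._≟_ FinP._≟_
        where import Data.Product.Properties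

  PinnedIsostatic : ∀ d {n m} → PinnedGraph n m → Set (c Level.⊔ ℓ)
  PinnedIsostatic d {n} G =
    (PinnedGraph.e G ≡ d ℕ.* n) ×
    Σ (Configuration d _ _) λ p → Invertible (PinnedGraph.e G) n d (rigidityMatrix G p)

-- Orientations: o k = true orients edge k from proj₁ to proj₂ of its
-- endpoint pair, o k = false orients it from proj₂ to proj₁.

Orientation : ∀ {n m} → PinnedGraph n m → Set
Orientation G = Fin (PinnedGraph.e G) → Bool

tail : ∀ {n m} (G : PinnedGraph n m) → Orientation G → Fin (PinnedGraph.e G) → Vertex n m
tail G o k = if o k then proj₁ (PinnedGraph.ends G k) else proj₂ (PinnedGraph.ends G k)

countFin : ∀ k → (Fin k → Bool) → ℕ
countFin zero    f = 0
countFin (suc k) f = (if f zero then 1 else 0) ℕ.+ countFin k (λ i → f (suc i))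

outDegree : ∀ {n m} (G : PinnedGraph n m) → Orientation G → Vertex n m → ℕ
outDegree G o w = countFin (PinnedGraph.e G) (λ k → does (tail G o k ≟V w))

DDirected : ∀ d {n m} (G : PinnedGraph n m) → Orientation G → Set
DDirected d G o = (∀ i → outDegree G o (inj₁ i) ≡ d) × (∀ j → outDegree G o (inj₂ j) ≡ 0)

module Submission where

open import Defs
open import Data.Nat using (ℕ; _≤_)
open import Data.Product using (Σ; _×_)
open import Algebra.Bundles using (CommutativeRing)

open import Algebra.Bundles using (Monoid)
import Algebra.Properties.CommutativeMonoid.Sum as CommutativeMonoidSum
import Algebra.Properties.Monoid.Sum as MonoidSum
import Algebra.Properties.Ring as RingProperties
import Algebra.Properties.Semiring.Sum as SemiringSum
import Algebra.Solver.Ring.NaturalCoefficients.Default as NaturalCoefficientsSolver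
open import Data.Bool using (Bool; false; if_then_else_)
open import Data.Fin using (Fin; zero; suc; punchIn; _↑ˡ_; _↑ʳ_; combine; remQuot; quotient; remainder)
import Data.Fin.Properties as FinP
open import Data.Fin.Permutation as Perm using (Permutation; _⟨$⟩ʳ_)
open import Data.Fin.Subset.Properties using (anySubset?)
open import Data.Nat as ℕ using (zero; suc)
import Data.Nat.Properties as ℕP
open import Data.Product using (_,_; proj₁; proj₂; ∃)
open import Data.Sum using (_⊎_; inj₁; inj₂)
open import Data.Vec using (lookup; tabulate)
open import Data.Vec.Properties using (lookup∘tabulate)
open import Data.Vec.Functional using (Vector)
open import Effect.Monad using (RawMonad)
open import Function using (_∘_)
open import Relation.Binary.PropositionalEquality as ≡ using (_≡_; _≗_)
open import Relation.Nullary using (¬_; Dec; yes; no; does; _×-dec_)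
open import Relation.Nullary.Decidable using (decidable-stable; dec-true; dec-false)
open import Relation.Nullary.Negation using (¬¬-Monad; ¬¬-map; contradiction)

-- If the pinned rigidity matrix M is invertible, Gaussian elimination
-- (pivoting on a nonzero entry of the first row of M S = 1) shows that M
-- has a transversal: a bijection π from edges to columns with every
-- entry M k (π k) nonzero.  A nonzero entry in row k at a column of the
-- inner vertex i forces i to be an endpoint of edge k, so orienting each
-- edge k away from the vertex owning column π k makes every inner vertex
-- the tail of exactly as many edges as it owns columns, namely d, and no
-- pinned vertex a tail at all.  Nonvanishing of field elements is not
-- decidable, so the transversal is only obtained under a double
-- negation, which is removed by searching the finitely many orientations.

module _ {a ℓ} (M : Monoid a ℓ) where
  open Monoid M renaming (_∙_ to _+_; ε to 0#)
  open MonoidSum M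
  open import Relation.Binary.Reasoning.Setoid setoid
  open RawMonad (¬¬-Monad {ℓ})

  sum-↑ : ∀ m n (f : Vector Carrier (m ℕ.+ n)) →
          sum f ≈ sum (f ∘ (_↑ˡ n)) + sum (f ∘ (m ↑ʳ_))
  sum-↑ zero    n f = sym (identityˡ (sum f))
  sum-↑ (suc m) n f = trans (∙-congˡ (sum-↑ m n (f ∘ suc))) (sym (assoc _ _ _))

  sum-combine : ∀ m n (f : Vector Carrier (m ℕ.* n)) →
                sum f ≈ ∑[ i < m ] ∑[ j < n ] f (combine i j)
  sum-combine zero    n f = refl
  sum-combine (suc m) n f =
    trans (sum-↑ n (m ℕ.* n) f) (∙-congˡ (sum-combine m n (f ∘ (n ↑ʳ_))))

  sum-remQuot : ∀ m n (g : Fin m × Fin n → Carrier) →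
                sum (g ∘ remQuot n) ≈ ∑[ i < m ] ∑[ j < n ] g (i , j)
  sum-remQuot m n g = begin
    sum (g ∘ remQuot n)                            ≈⟨ sum-combine m n (g ∘ remQuot n) ⟩
    ∑[ i < m ] ∑[ j < n ] g (remQuot n (combine i j))
      ≡⟨ sum-cong-≗ (λ i → sum-cong-≗ (λ j → ≡.cong g (FinP.remQuot-combine i j))) ⟩
    ∑[ i < m ] ∑[ j < n ] g (i , j)                ∎

  sum-¬¬≈0 : ∀ {n} (f : Vector Carrier n) → (∀ i → ¬ ¬ f i ≈ 0#) → ¬ ¬ sum f ≈ 0#
  sum-¬¬≈0 {zero}  f f≈0 = pure refl
  sum-¬¬≈0 {suc n} f f≈0 = do
    f₀≈0 ← f≈0 zero
    rest≈0 ← sum-¬¬≈0 (f ∘ suc) (f≈0 ∘ suc)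
    pure (trans (∙-cong f₀≈0 rest≈0) (identityˡ 0#))

  sum≉0⇒¬¬∃≉0 : ∀ {n} (f : Vector Carrier n) → ¬ sum f ≈ 0# → ¬ ¬ ∃ λ i → ¬ f i ≈ 0#
  sum≉0⇒¬¬∃≉0 f sum≉0 ∄ = sum-¬¬≈0 f (λ i fi≉0 → ∄ (i , fi≉0)) sum≉0

module Count = CommutativeMonoidSum ℕP.+-0-commutativeMonoid

countFin≡sum : ∀ k (f : Fin k → Bool) → countFin k f ≡ Count.sum (λ i → if f i then 1 else 0)
countFin≡sum zero    f = ≡.refl
countFin≡sum (suc k) f = ≡.cong ((if f zero then 1 else 0) ℕ.+_) (countFin≡sum k (f ∘ suc))

countFin-cong : ∀ k {f g : Fin k → Bool} → (∀ i → f i ≡ g i) → countFin k f ≡ countFin k g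
countFin-cong zero    f≗g = ≡.refl
countFin-cong (suc k) f≗g =
  ≡.cong₂ (λ b c → (if b then 1 else 0) ℕ.+ c) (f≗g zero) (countFin-cong k (f≗g ∘ suc))

countFin-permute : ∀ {m n} (π : Permutation m n) (Q : Fin n → Bool) →
                   countFin m (Q ∘ (π ⟨$⟩ʳ_)) ≡ countFin n Q
countFin-permute {m} {n} π Q = begin
  countFin m (Q ∘ (π ⟨$⟩ʳ_))                 ≡⟨ countFin≡sum m _ ⟩
  Count.sum (λ k → if Q (π ⟨$⟩ʳ k) then 1 else 0) ≡⟨ Count.sum-permute _ π ⟨
  Count.sum (λ x → if Q x then 1 else 0)     ≡⟨ countFin≡sum n Q ⟨
  countFin n Q                               ∎
  where open ≡.≡-Reasoning

countFin-false : ∀ k → countFin k (λ _ → false) ≡ 0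
countFin-false k = ≡.trans (countFin≡sum k _) (Count.sum-replicate-zero k)

sum-ones : ∀ n → Count.∑[ _ < n ] 1 ≡ n
sum-ones zero    = ≡.refl
sum-ones (suc n) = ≡.cong suc (sum-ones n)

sum-indicator : ∀ {n} (i : Fin n) → Count.∑[ j < n ] (if does (j FinP.≟ i) then 1 else 0) ≡ 1
sum-indicator {suc n} i = begin
  Count.∑[ j < suc n ] [ j ]                    ≡⟨ Count.sum-remove {i = i} [_] ⟩
  [ i ] ℕ.+ Count.∑[ j < n ] [ punchIn i j ]    ≡⟨ ≡.cong₂ ℕ._+_ i-counted others-not ⟩
  1 ℕ.+ Count.∑[ _ < n ] 0                      ≡⟨ ≡.cong suc (Count.sum-replicate-zero n) ⟩
  1                                             ∎
  where
  open ≡.≡-Reasoning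
  [_] : Fin (suc n) → ℕ
  [ j ] = if does (j FinP.≟ i) then 1 else 0
  i-counted : [ i ] ≡ 1
  i-counted = ≡.cong (if_then 1 else 0) (dec-true (i FinP.≟ i) ≡.refl)
  others-not : Count.∑[ j < n ] [ punchIn i j ] ≡ Count.∑[ _ < n ] 0
  others-not = Count.sum-cong-≗ (λ j →
    ≡.cong (if_then 1 else 0) (dec-false (punchIn i j FinP.≟ i) (FinP.punchInᵢ≢i i j)))

countFin-quotient : ∀ n d (i : Fin n) → countFin (n ℕ.* d) (λ x → does (quotient d x FinP.≟ i)) ≡ d
countFin-quotient n d i = begin
  countFin (n ℕ.* d) (λ x → does (quotient d x FinP.≟ i))    ≡⟨ countFin≡sum (n ℕ.* d) _ ⟩
  Count.sum ([_] ∘ remQuot d)                                ≡⟨ sum-remQuot ℕP.+-0-monoid n d [_] ⟩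
  Count.∑[ j < n ] Count.∑[ a < d ] [ j , a ]                ≡⟨ Count.∑-comm (λ j a → [ j , a ]) ⟩
  Count.∑[ a < d ] Count.∑[ j < n ] [ j , a ]                ≡⟨ Count.sum-cong-≗ {d} (λ _ → sum-indicator i) ⟩
  Count.∑[ _ < d ] 1                                         ≡⟨ sum-ones d ⟩
  d                                                          ∎
  where
  open ≡.≡-Reasoning
  [_] : Fin n × Fin d → ℕ
  [ j , _ ] = if does (j FinP.≟ i) then 1 else 0

module _ {r ℓ} (R : CommutativeRing r ℓ) where
  open CommutativeRing R hiding (zero)
  open RingProperties ring using (-‿distribʳ-*)
  open SemiringSum semiring
  open NaturalCoefficientsSolver commutativeSemiring using (solve; _:+_; _:*_; _:=_)
  open import Relation.Binary.Reasoning.Setoid setoid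

  ΣFin≡sum : ∀ k (f : Fin k → Carrier) → ΣFin R k f ≡ sum f
  ΣFin≡sum zero    f = ≡.refl
  ΣFin≡sum (suc k) f = ≡.cong (f zero +_) (ΣFin≡sum k (f ∘ suc))

  ΣFin²≡∑∑ : ∀ n d (g : Fin n → Fin d → Carrier) → ΣFin R n (λ i → ΣFin R d (g i)) ≡ ∑[ i < n ] ∑[ a < d ] g i a
  ΣFin²≡∑∑ n d g = ≡.trans (ΣFin≡sum n _) (sum-cong-≗ (λ i → ΣFin≡sum d (g i)))

  IsRightInverse : ∀ {m n} → (Fin m → Fin n → Carrier) → (Fin n → Fin m → Carrier) → Set ℓ
  IsRightInverse {n = n} M S = ∀ k l → ∑[ x < n ] (M k x * S x l) ≈ idMat R FinP._≟_ k l

  Transversal : ∀ {m n} → (Fin m → Fin n → Carrier) → Set ℓ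
  Transversal {m} {n} M = Σ (Permutation m n) λ π → ∀ k → ¬ M k (π ⟨$⟩ʳ k) ≈ 0#

  rightInverse-remQuot : ∀ {e n d} {M : Fin e → Fin n × Fin d → Carrier}
                           {S : Fin n × Fin d → Fin e → Carrier} →
    (∀ k l → ΣFin R n (λ i → ΣFin R d (λ a → M k (i , a) * S (i , a) l)) ≈ idMat R FinP._≟_ k l) →
    IsRightInverse (λ k → M k ∘ remQuot d) (S ∘ remQuot d)
  rightInverse-remQuot {n = n} {d} {M} {S} MS≈1 k l = begin
    sum (λ x → M k (remQuot d x) * S (remQuot d x) l)
      ≈⟨ sum-remQuot +-monoid n d (λ ia → M k ia * S ia l) ⟩
    ∑[ i < n ] ∑[ a < d ] (M k (i , a) * S (i , a) l)
      ≡⟨ ΣFin²≡∑∑ n d (λ i a → M k (i , a) * S (i , a) l) ⟨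
    ΣFin R n (λ i → ΣFin R d (λ a → M k (i , a) * S (i , a) l))
      ≈⟨ MS≈1 k l ⟩
    idMat R FinP._≟_ k l
      ∎

  x*y≉0⇒x≉0 : ∀ {x y} → ¬ x * y ≈ 0# → ¬ x ≈ 0#
  x*y≉0⇒x≉0 {x} {y} xy≉0 x≈0 = xy≉0 (trans (*-congʳ x≈0) (zeroˡ y))

  x*y≉0⇒y≉0 : ∀ {x y} → ¬ x * y ≈ 0# → ¬ y ≈ 0#
  x*y≉0⇒y≉0 {x} {y} xy≉0 y≈0 = xy≉0 (trans (*-congˡ y≈0) (zeroʳ x))

  ∑-*-affine : ∀ {n} (f g h : Vector Carrier n) c →
               ∑[ x < n ] (f x * (g x + h x * c)) ≈ ∑[ x < n ] (f x * g x) + (∑[ x < n ] (f x * h x)) * c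
  ∑-*-affine {n} f g h c = begin
    ∑[ x < n ] (f x * (g x + h x * c))
      ≈⟨ sum-cong-≋ (λ x → trans (distribˡ (f x) _ _) (+-congˡ (sym (*-assoc _ _ _)))) ⟩
    ∑[ x < n ] (f x * g x + f x * h x * c)
      ≈⟨ ∑-distrib-+ (λ x → f x * g x) (λ x → f x * h x * c) ⟩
    ∑[ x < n ] (f x * g x) + ∑[ x < n ] (f x * h x * c)
      ≈⟨ +-congˡ (sym (*-distribʳ-sum c (λ x → f x * h x))) ⟩
    ∑[ x < n ] (f x * g x) + (∑[ x < n ] (f x * h x)) * c
      ∎

  pivot-cancel : ∀ {s t} q → s * t ≈ 1# → s * - (t * q) + q ≈ 0#
  pivot-cancel {s} {t} q st≈1 = begin
    s * - (t * q) + q    ≈⟨ +-congʳ (sym (-‿distribʳ-* s (t * q))) ⟩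
    - (s * (t * q)) + q  ≈⟨ +-congʳ (-‿cong (sym (*-assoc s t q))) ⟩
    - (s * t * q) + q    ≈⟨ +-congʳ (-‿cong (trans (*-congʳ st≈1) (*-identityˡ q))) ⟩
    - q + q              ≈⟨ -‿inverseˡ q ⟩
    0#                   ∎

  -- Gaussian elimination with pivot S j 0: adding multiples of column 0
  -- of S to the others clears row j outside column 0, after which row 0
  -- and column j of M and row j and column 0 of S can be deleted.
  eliminate : ∀ {m n} {M : Fin (suc m) → Fin (suc n) → Carrier} {S : Fin (suc n) → Fin (suc m) → Carrier} →
              IsRightInverse M S → ∀ j t → S j zero * t ≈ 1# →
              IsRightInverse (λ k x → M (suc k) (punchIn j x))
                             (λ x l → S (punchIn j x) (suc l) + S (punchIn j x) zero * - (t * S j (suc l)))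
  eliminate {m} {n} {M} {S} MS≈1 j t st≈1 k l = begin
    ∑[ x < n ] (M′ x * (S′ x (suc l) + S′ x zero * c))
      ≈⟨ ∑-*-affine M′ (λ x → S′ x (suc l)) (λ x → S′ x zero) c ⟩
    B + A * c
      ≈⟨ absorb ⟩
    (Mkj * S j (suc l) + B) + (Mkj * S j zero + A) * c
      ≈⟨ +-cong (expand (suc l)) (*-congʳ (expand zero)) ⟩
    idMat R FinP._≟_ k l + 0# * c
      ≈⟨ trans (+-congˡ (zeroˡ c)) (+-identityʳ _) ⟩
    idMat R FinP._≟_ k l
      ∎
    where
    M′ : Fin n → Carrier
    M′ x = M (suc k) (punchIn j x)
    S′ : Fin n → Fin (suc m) → Carrier
    S′ x = S (punchIn j x)
    Mkj c B A : Carrier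
    Mkj = M (suc k) j
    c = - (t * S j (suc l))
    B = ∑[ x < n ] (M′ x * S′ x (suc l))
    A = ∑[ x < n ] (M′ x * S′ x zero)
    expand : ∀ l′ → Mkj * S j l′ + ∑[ x < n ] (M′ x * S′ x l′) ≈ idMat R FinP._≟_ (suc k) l′
    expand l′ = trans (sym (sum-remove {i = j} (λ x → M (suc k) x * S x l′))) (MS≈1 (suc k) l′)
    absorb : B + A * c ≈ (Mkj * S j (suc l) + B) + (Mkj * S j zero + A) * c
    absorb = sym (begin
      (Mkj * S j (suc l) + B) + (Mkj * S j zero + A) * c
        ≈⟨ solve 6 (λ m q s b a c → (m :* q :+ b) :+ (m :* s :+ a) :* c
                                    := (b :+ a :* c) :+ m :* (s :* c :+ q))
                   refl Mkj (S j (suc l)) (S j zero) B A c ⟩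
      (B + A * c) + Mkj * (S j zero * c + S j (suc l))
        ≈⟨ +-congˡ (*-congˡ (pivot-cancel (S j (suc l)) st≈1)) ⟩
      (B + A * c) + Mkj * 0#
        ≈⟨ trans (+-congˡ (zeroʳ Mkj)) (+-identityʳ _) ⟩
      B + A * c
        ∎)

  module _ (isField : IsField R) where
    open RawMonad (¬¬-Monad {ℓ})

    rightInverse⇒¬¬transversal : ∀ {m n} → m ≡ n → {M : Fin m → Fin n → Carrier} {S : Fin n → Fin m → Carrier} →
                                 IsRightInverse M S → ¬ ¬ Transversal M
    rightInverse⇒¬¬transversal {zero}  {zero}  _ _ = pure (Perm.id , λ ())
    rightInverse⇒¬¬transversal {zero}  {suc n} () _
    rightInverse⇒¬¬transversal {suc m} {zero}  () _
    rightInverse⇒¬¬transversal {suc m} {suc n} m≡n {M} {S} MS≈1 = do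
      (j , MSj≉0) ← sum≉0⇒¬¬∃≉0 +-monoid (λ x → M zero x * S x zero)
                      (λ sum≈0 → proj₁ isField (trans (sym (MS≈1 zero zero)) sum≈0))
      let (t , st≈1) = proj₂ isField (S j zero) (x*y≉0⇒y≉0 MSj≉0)
      (π , π-nonzero) ← rightInverse⇒¬¬transversal (ℕP.suc-injective m≡n) (eliminate {M = M} {S = S} MS≈1 j t st≈1)
      pure (Perm.insert zero j π , λ where
        zero    → x*y≉0⇒x≉0 MSj≉0
        (suc k) → ≡.subst (λ x → ¬ M (suc k) x ≈ 0#) (≡.sym (Perm.insert-punchIn zero j π k)) (π-nonzero k))

module _ {n m} (G : PinnedGraph n m) where
  open PinnedGraph G

  IsEndpoint : Fin e → Vertex n m → Set
  IsEndpoint k w = proj₁ (ends k) ≡ w ⊎ proj₂ (ends k) ≡ w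

  orientAwayFrom : (Fin e → Vertex n m) → Orientation G
  orientAwayFrom w k = does (proj₁ (ends k) ≟V w k)

  tail-orientAwayFrom : ∀ w k → IsEndpoint k (w k) → tail G (orientAwayFrom w) k ≡ w k
  tail-orientAwayFrom w k endpoint with proj₁ (ends k) ≟V w k | endpoint
  ... | yes u≡w | _        = u≡w
  ... | no  u≢w | inj₁ u≡w = contradiction u≡w u≢w
  ... | no  _   | inj₂ v≡w = v≡w

  outDegree-orientAwayFrom : ∀ w → (∀ k → IsEndpoint k (w k)) →
                             ∀ x → outDegree G (orientAwayFrom w) x ≡ countFin e (λ k → does (w k ≟V x))
  outDegree-orientAwayFrom w endpoint x =
    countFin-cong e (λ k → ≡.cong (λ y → does (y ≟V x)) (tail-orientAwayFrom w k (endpoint k)))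

  DDirected-resp-≗ : ∀ {d} {o o′ : Orientation G} → o ≗ o′ → DDirected d G o → DDirected d G o′
  DDirected-resp-≗ {o = o} {o′} o≗o′ (inner , pinned) =
    (λ i → ≡.trans (≡.sym (same-outDegree (inj₁ i))) (inner i)) ,
    (λ j → ≡.trans (≡.sym (same-outDegree (inj₂ j))) (pinned j))
    where
    same-outDegree : ∀ x → outDegree G o x ≡ outDegree G o′ x
    same-outDegree x = countFin-cong e (λ k → ≡.cong (λ b → does (tail′ b k ≟V x)) (o≗o′ k))
      where
      tail′ : Bool → Fin e → Vertex n m
      tail′ b k = if b then proj₁ (ends k) else proj₂ (ends k)

dDirected? : ∀ d {n m} (G : PinnedGraph n m) (o : Orientation G) → Dec (DDirected d G o)
dDirected? d G o = FinP.all? (λ i → outDegree G o (inj₁ i) ℕP.≟ d)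
                   ×-dec FinP.all? (λ j → outDegree G o (inj₂ j) ℕP.≟ 0)

module _ {r ℓ} (R : CommutativeRing r ℓ) where
  open CommutativeRing R using (_≈_; 0#; +-identityˡ)

  rigidityMatrix≉0⇒endpoint : ∀ {d n m} (G : PinnedGraph n m) (p : Configuration R d n m) k i a →
                              ¬ rigidityMatrix R G p k (i , a) ≈ 0# → IsEndpoint G k (inj₁ i)
  rigidityMatrix≉0⇒endpoint G p k i a entry≉0 with proj₁ (PinnedGraph.ends G k) ≟V inj₁ i
  ... | yes u≡i = inj₁ u≡i
  ... | no  _ with proj₂ (PinnedGraph.ends G k) ≟V inj₁ i
  ...   | yes v≡i = inj₂ v≡i
  ...   | no  _   = contradiction (+-identityˡ 0#) entry≉0

  transversal⇒dDirected : ∀ {d n m} (G : PinnedGraph n m) (p : Configuration R d n m) →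
    (π : Permutation (PinnedGraph.e G) (n ℕ.* d)) →
    (∀ k → ¬ rigidityMatrix R G p k (remQuot d (π ⟨$⟩ʳ k)) ≈ 0#) →
    DDirected d G (orientAwayFrom G (λ k → inj₁ (quotient d (π ⟨$⟩ʳ k))))
  transversal⇒dDirected {d} {n} {m} G p π π-nonzero = inner , pinned
    where
    w : Fin (PinnedGraph.e G) → Vertex n m
    w k = inj₁ (quotient d (π ⟨$⟩ʳ k))
    endpoint : ∀ k → IsEndpoint G k (w k)
    endpoint k = rigidityMatrix≉0⇒endpoint G p k (quotient d (π ⟨$⟩ʳ k)) (remainder {n} d (π ⟨$⟩ʳ k)) (π-nonzero k)
    inner : ∀ i → outDegree G (orientAwayFrom G w) (inj₁ i) ≡ d
    inner i = ≡.trans (outDegree-orientAwayFrom G w endpoint (inj₁ i))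
                (≡.trans (countFin-permute π (λ x → does (quotient d x FinP.≟ i)))
                         (countFin-quotient n d i))
    pinned : ∀ j → outDegree G (orientAwayFrom G w) (inj₂ j) ≡ 0
    pinned j = ≡.trans (outDegree-orientAwayFrom G w endpoint (inj₂ j)) (countFin-false (PinnedGraph.e G))

proposition3p2 : ∀ {c ℓ} (R : CommutativeRing c ℓ) → IsField R →
    (d : ℕ) → 1 ≤ d → ∀ {n m} (G : PinnedGraph n m) →
    PinnedIsostatic R d G → Σ (Orientation G) (DDirected d G)
proposition3p2 R isField d _ {n} G (e≡d*n , p , S , MS≈1 , _) =
  let (v , v-dDirected) = decidable-stable (anySubset? (dDirected? d G ∘ lookup)) ¬¬dDirected
  in lookup v , v-dDirected
  where
  orient : Transversal R (λ k → rigidityMatrix R G p k ∘ remQuot d) → ∃ λ v → DDirected d G (lookup v)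
  orient (π , π-nonzero) =
    tabulate o , DDirected-resp-≗ G (≡.sym ∘ lookup∘tabulate o) (transversal⇒dDirected R G p π π-nonzero)
    where
    o : Orientation G
    o = orientAwayFrom G (λ k → inj₁ (quotient d (π ⟨$⟩ʳ k)))
  ¬¬dDirected : ¬ ¬ ∃ λ v → DDirected d G (lookup v)
  ¬¬dDirected = ¬¬-map orient (rightInverse⇒¬¬transversal R isField (≡.trans e≡d*n (ℕP.*-comm d n))
                                 (rightInverse-remQuot R {M = rigidityMatrix R G p} {S = S} MS≈1))
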